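{- Let $\dot G\in\mathcal C_1\cup\mathcal C_4\cup\mathcal C_5$ be a connected, non-complete, $6$-regular strongly regular signed graph with net-degree $4$ at every vertex. Then $\dot G$ contains no unbalanced triangle.
   Context: Signed graphs. - A signed graph $\dot G=(G,\sigma)$ is a simple graph $G$ (the underlying graph) with a sign function $\sigma:E(G)\to\{\pm1\}$. - The adjacency matrix has entries $\sigma(v_iv_j)$ for adjacent pairs and $0$ otherwise. - Connected, complete and regular refer to $G$. - The net-degree of $v$ is (number of positive edges at $v$) $-$ (number of negative edges at $v$). - $\dot G$ is homogeneous if all edges have the same sign, inhomogeneous otherwise. - The sign of a triangle is the product of the signs of its edges. A triangle is unbalanced if its sign is negative. Strongly regular signed graphs. - An SRSG is a signed graph on $n$ vertices, neither homogeneous complete nor edgeless, for which there are $r\in\mathbb N$ and $a,b,c\in\mathbb Z$ such that the entries of $A(\dot G)^2$ are: - $r$ on the diagonal; - $a$ for pairs joined by a positive edge; - $b$ for pairs joined by a negative edge; - $c$ for distinct non-adjacent pairs. - $(n,r,a,b,c)$ are its parameters. Classes of inhomogeneous SRSGs. - $\mathcal C_1$: $a=-b$, and either complete, or non-complete with $c\neq0$. - $\mathcal C_4$: $a\neq -b$, non-complete, $c=0$. - $\mathcal C_5$: $a\ne-b$, non-complete, $c\ne\frac{a+b}{2}$ and $c\neq 0$. -}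

module Defs where

open import Data.Nat using (ℕ; zero; suc)
open import Data.Integer using (ℤ; +_; -_; _*_; _+_; _-_; 0ℤ; 1ℤ; -1ℤ)
import Data.Integer as ℤ
open import Data.Fin using (Fin; zero; suc)
open import Data.Bool using (Bool; true; false)
open import Data.Sum using (_⊎_)
open import Data.Product using (_×_)
open import Relation.Binary.PropositionalEquality using (_≡_; _≢_)
open import Relation.Nullary using (¬_)
open import Relation.Nullary.Decidable using (⌊_⌋)
open import Relation.Binary.Construct.Closure.ReflexiveTransitive using (Star)

-- A signed graph on the vertex set Fin n, given by its adjacency matrix:
-- entries in {0, 1, -1}, symmetric, zero diagonal (simple graph).
-- Entry σ(v_i v_j) for an edge, 0 for a non-edge.
record SignedGraph (n : ℕ) : Set where
  field
    A       : Fin n → Fin n → ℤ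
    entries : ∀ i j → A i j ≡ 0ℤ ⊎ (A i j ≡ 1ℤ ⊎ A i j ≡ -1ℤ)
    symm    : ∀ i j → A i j ≡ A j i
    loopless : ∀ i → A i i ≡ 0ℤ

open SignedGraph public

sumFin : ∀ {n} → (Fin n → ℤ) → ℤ
sumFin {zero}  f = 0ℤ
sumFin {suc n} f = f zero + sumFin (λ k → f (suc k))

countFin : ∀ {n} → (Fin n → Bool) → ℕ
countFin {zero}  p = 0
countFin {suc n} p with p zero
... | true  = suc (countFin (λ k → p (suc k)))
... | false = countFin (λ k → p (suc k))

module _ {n : ℕ} (G : SignedGraph n) where

  A² : Fin n → Fin n → ℤ
  A² i j = sumFin (λ k → A G i k * A G k j)

  Adjacent : Fin n → Fin n → Set
  Adjacent i j = A G i j ≢ 0ℤ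

  posDeg : Fin n → ℕ
  posDeg i = countFin (λ k → ⌊ A G i k ℤ.≟ 1ℤ ⌋)

  negDeg : Fin n → ℕ
  negDeg i = countFin (λ k → ⌊ A G i k ℤ.≟ -1ℤ ⌋)

  degree : Fin n → ℕ
  degree i = countFin (λ k → Data.Bool.not ⌊ A G i k ℤ.≟ 0ℤ ⌋)

  netDegree : Fin n → ℤ
  netDegree i = + posDeg i - + negDeg i

  Regular : ℕ → Set
  Regular r = ∀ i → degree i ≡ r

  Connected : Set
  Connected = ∀ i j → Star Adjacent i j

  Complete : Set
  Complete = ∀ i j → i ≢ j → Adjacent i j

  Edgeless : Set
  Edgeless = ∀ i j → A G i j ≡ 0ℤ

  Homogeneous : Set
  Homogeneous = (∀ i j → A G i j ≢ -1ℤ) ⊎ (∀ i j → A G i j ≢ 1ℤ)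

  Inhomogeneous : Set
  Inhomogeneous = ¬ Homogeneous

  record IsSRSG (r : ℕ) (a b c : ℤ) : Set where
    field
      notHomComplete : ¬ (Homogeneous × Complete)
      notEdgeless    : ¬ Edgeless
      diag  : ∀ i → A² i i ≡ + r
      posE  : ∀ i j → A G i j ≡ 1ℤ → A² i j ≡ a
      negE  : ∀ i j → A G i j ≡ -1ℤ → A² i j ≡ b
      nonE  : ∀ i j → i ≢ j → A G i j ≡ 0ℤ → A² i j ≡ c

  -- classes of inhomogeneous SRSGs (inhomogeneity is required separately)
  ClassC1 : ℤ → ℤ → ℤ → Set
  ClassC1 a b c = a ≡ - b × (Complete ⊎ (¬ Complete × c ≢ 0ℤ))

  ClassC4 : ℤ → ℤ → ℤ → Set
  ClassC4 a b c = a ≢ - b × ¬ Complete × c ≡ 0ℤ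

  -- c ≠ (a+b)/2 is stated as 2c ≠ a + b
  ClassC5 : ℤ → ℤ → ℤ → Set
  ClassC5 a b c = a ≢ - b × ¬ Complete × (+ 2 * c ≢ a + b) × c ≢ 0ℤ

  UnbalancedTriangle : Fin n → Fin n → Fin n → Set
  UnbalancedTriangle i j k =
    Adjacent i j × Adjacent j k × Adjacent k i × (A G i j * A G j k * A G k i ≡ -1ℤ)

-- Six-regularity with net-degree 4 leaves every vertex with five positive neighbours and exactly
-- one negative one, so the negative edges form a perfect matching x ↦ x′ with permutation matrix N.
-- In the identity A² = cJ + (r − c)I + (a − c)A + (a + b − 2c)N the matrix A commutes with A², I and
-- (having constant row sums) with J; as a + b ≠ 2c it commutes with N, that is A(x, y′) = A(x′, y).
--
-- An unbalanced triangle then has exactly one negative edge uv, so v = u′, and together with w the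
-- vertex w′ is a common positive neighbour of u and v. Let x, y, z be the other positive neighbours
-- of u and expand A²(u, ·) along the row of u. If no two of x, y, z are matched, v is adjacent to
-- none of them, and the values A²(u, t) = a for t = x, y, z, w, w′ give both
-- a = 4 + 2(A(x,y) + A(x,z) + A(y,z)) ≥ 4 and a = A(x,w) + A(y,w) + A(z,w) − 2 ≤ 1.
-- If x′ = y, the expansion gives b = A²(u, v) = 4 and a − c = A²(u, z) − A²(u, z′) = 2, and summing
-- a row of A² gives 16 = 6 + 5a + b + c(n − 7), i.e. c(n − 2) = −4, impossible since n ≥ 7.

{-# OPTIONS --safe #-}
module Submission where

open import Defs
open import Data.Nat as ℕ using (ℕ; zero; suc; z≤n; s≤s)
import Data.Nat.Properties as ℕP
open import Data.Integer as ℤ using (ℤ; +_; -[1+_]; _+_; _*_; _-_; -_; 0ℤ; 1ℤ; -1ℤ; _≤_; +≤+; -≤+)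
import Data.Integer.Properties as ℤP
open import Data.Integer.Tactic.RingSolver using (solve-∀)
open import Data.Fin using (Fin; zero; suc; _≟_)
open import Data.Fin.Patterns using (0F; 1F; 2F; 3F; 4F)
open import Data.Vec.Functional using (Vector; _∷_; [])
open import Data.Bool using (Bool; true; false; not)
open import Data.Sum using (_⊎_; inj₁; inj₂; [_,_]′)
open import Data.Product using (_×_; _,_; ∃; proj₁; proj₂)
open import Data.Empty using (⊥; ⊥-elim)
open import Function using (_∘_; id; case_of_; Injective)
open import Relation.Binary.PropositionalEquality
open import Relation.Nullary using (¬_; yes; no; does)
open import Relation.Nullary.Decidable using (⌊_⌋)
open import Algebra.Properties.AbelianGroup ℤP.+-0-abelianGroup using (∙-cancelˡ)
open import Algebra.Properties.Semiring.Sum ℤP.+-*-semiring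
  using (sum; sum-syntax; sum-cong-≗; sum-replicate-zero; ∑-comm; ∑-distrib-+; *-distribˡ-sum; *-distribʳ-sum)

sumFin≡sum : ∀ {n} (f : Fin n → ℤ) → sumFin f ≡ sum f
sumFin≡sum {zero}  f = refl
sumFin≡sum {suc n} f = cong (λ s → f zero + s) (sumFin≡sum (f ∘ suc))

sum-nonneg : ∀ {n} {f : Fin n → ℤ} → (∀ k → 0ℤ ≤ f k) → 0ℤ ≤ sum f
sum-nonneg {zero}  f≥0 = ℤP.≤-refl
sum-nonneg {suc n} f≥0 = ℤP.+-mono-≤ (f≥0 zero) (sum-nonneg (f≥0 ∘ suc))

nonneg⇒≤sum : ∀ {n} {f : Fin n → ℤ} → (∀ k → 0ℤ ≤ f k) → ∀ i → f i ≤ sum f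
nonneg⇒≤sum {suc n} {f} f≥0 zero =
  subst (_≤ sum f) (ℤP.+-identityʳ (f zero)) (ℤP.+-monoʳ-≤ (f zero) (sum-nonneg (f≥0 ∘ suc)))
nonneg⇒≤sum {suc n} {f} f≥0 (suc i) =
  subst (_≤ sum f) (ℤP.+-identityˡ (f (suc i))) (ℤP.+-mono-≤ (f≥0 zero) (nonneg⇒≤sum (f≥0 ∘ suc) i))

nonneg-sum≡0 : ∀ {n} {f : Fin n → ℤ} → (∀ k → 0ℤ ≤ f k) → sum f ≡ 0ℤ → ∀ k → f k ≡ 0ℤ
nonneg-sum≡0 {f = f} f≥0 Σf≡0 k =
  ℤP.≤-antisym (subst (f k ≤_) Σf≡0 (nonneg⇒≤sum f≥0 k)) (f≥0 k)

sum≢0⇒∃≢0 : ∀ {n} (f : Fin n → ℤ) → sum f ≢ 0ℤ → ∃ λ k → f k ≢ 0ℤ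
sum≢0⇒∃≢0 {zero}  f Σf≢0 = ⊥-elim (Σf≢0 refl)
sum≢0⇒∃≢0 {suc n} f Σf≢0 with f zero ℤ.≟ 0ℤ
... | no  f₀≢0 = zero , f₀≢0
... | yes f₀≡0 with sum≢0⇒∃≢0 (f ∘ suc) (λ Σ≡0 → Σf≢0 (cong₂ _+_ f₀≡0 Σ≡0))
...   | k , fk≢0 = suc k , fk≢0

sum-minus : ∀ {n} (f g : Fin n → ℤ) → ∑[ k < n ] (f k - g k) ≡ sum f - sum g
sum-minus {n} f g = begin
  ∑[ k < n ] (f k - g k)         ≡⟨ ∑-distrib-+ f (λ k → - g k) ⟩
  sum f + ∑[ k < n ] (- g k)     ≡⟨ cong (λ s → sum f + s) (sum-cong-≗ λ k → sym (ℤP.-1*i≡-i (g k))) ⟩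
  sum f + ∑[ k < n ] (-1ℤ * g k) ≡⟨ cong (λ s → sum f + s) (sym (*-distribˡ-sum -1ℤ g)) ⟩
  sum f + -1ℤ * sum g            ≡⟨ cong (λ s → sum f + s) (ℤP.-1*i≡-i (sum g)) ⟩
  sum f - sum g                  ∎
  where open ≡-Reasoning

sum-one : ∀ n → ∑[ k < n ] 1ℤ ≡ + n
sum-one zero    = refl
sum-one (suc n) = cong (λ s → 1ℤ + s) (sum-one n)

sum-lincomb : ∀ {n} (α β γ κ : ℤ) (f g h l : Fin n → ℤ) →
  ∑[ k < n ] (α * f k + β * g k + γ * h k + κ * l k) ≡ α * sum f + β * sum g + γ * sum h + κ * sum l
sum-lincomb {n} α β γ κ f g h l = begin
  ∑[ k < n ] (α * f k + β * g k + γ * h k + κ * l k)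
    ≡⟨ ∑-distrib-+ (λ k → α * f k + β * g k + γ * h k) (λ k → κ * l k) ⟩
  ∑[ k < n ] (α * f k + β * g k + γ * h k) + ∑[ k < n ] (κ * l k)
    ≡⟨ cong (_+ ∑[ k < n ] (κ * l k)) (∑-distrib-+ (λ k → α * f k + β * g k) (λ k → γ * h k)) ⟩
  ∑[ k < n ] (α * f k + β * g k) + ∑[ k < n ] (γ * h k) + ∑[ k < n ] (κ * l k)
    ≡⟨ cong (λ s → s + ∑[ k < n ] (γ * h k) + ∑[ k < n ] (κ * l k)) (∑-distrib-+ (λ k → α * f k) (λ k → β * g k)) ⟩
  ∑[ k < n ] (α * f k) + ∑[ k < n ] (β * g k) + ∑[ k < n ] (γ * h k) + ∑[ k < n ] (κ * l k)
    ≡⟨ sym (cong₂ _+_ (cong₂ _+_ (cong₂ _+_ (*-distribˡ-sum α f) (*-distribˡ-sum β g)) (*-distribˡ-sum γ h))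
                      (*-distribˡ-sum κ l)) ⟩
  α * sum f + β * sum g + γ * sum h + κ * sum l ∎
  where open ≡-Reasoning

𝟙 : Bool → ℤ
𝟙 true  = 1ℤ
𝟙 false = 0ℤ

+countFin≡sum : ∀ {n} (p : Fin n → Bool) → + countFin p ≡ sum (𝟙 ∘ p)
+countFin≡sum {zero}  p = refl
+countFin≡sum {suc n} p with p zero
... | true  = cong (λ s → 1ℤ + s) (+countFin≡sum (p ∘ suc))
... | false = trans (+countFin≡sum (p ∘ suc)) (sym (ℤP.+-identityˡ _))

countFin≤ : ∀ {n} (p : Fin n → Bool) → countFin p ℕ.≤ n
countFin≤ {zero}  p = z≤n
countFin≤ {suc n} p with p zero
... | true  = s≤s (countFin≤ (p ∘ suc))
... | false = ℕP.m≤n⇒m≤1+n (countFin≤ (p ∘ suc))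

countFin< : ∀ {n} (p : Fin n → Bool) {i} → p i ≡ false → countFin p ℕ.< n
countFin< {suc n} p {zero}  pi≡false with p zero | pi≡false
... | false | _  = s≤s (countFin≤ (p ∘ suc))
... | true  | ()
countFin< {suc n} p {suc i} pi≡false with p zero
... | true  = s≤s (countFin< (p ∘ suc) pi≡false)
... | false = ℕP.m≤n⇒m≤1+n (countFin< (p ∘ suc) pi≡false)

δ : ∀ {n} → Fin n → Fin n → ℤ
δ i j = 𝟙 (does (i ≟ j))

δ-refl : ∀ {n} (i : Fin n) → δ i i ≡ 1ℤ
δ-refl i with i ≟ i
... | yes _   = refl
... | no i≢i = ⊥-elim (i≢i refl)

δ-≢ : ∀ {n} {i j : Fin n} → i ≢ j → δ i j ≡ 0ℤ
δ-≢ {i = i} {j} i≢j with i ≟ j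
... | yes i≡j = ⊥-elim (i≢j i≡j)
... | no  _   = refl

δ-sym : ∀ {n} (i j : Fin n) → δ i j ≡ δ j i
δ-sym i j with i ≟ j | j ≟ i
... | yes _   | yes _   = refl
... | no  _   | no  _   = refl
... | yes i≡j | no  j≢i = ⊥-elim (j≢i (sym i≡j))
... | no  i≢j | yes j≡i = ⊥-elim (i≢j (sym j≡i))

δ-nonneg : ∀ {n} (i j : Fin n) → 0ℤ ≤ δ i j
δ-nonneg i j with i ≟ j
... | yes _ = +≤+ z≤n
... | no  _ = +≤+ z≤n

δ≢0⇒≡ : ∀ {n} {i j : Fin n} → δ i j ≢ 0ℤ → i ≡ j
δ≢0⇒≡ {i = i} {j} δij≢0 with i ≟ j
... | yes i≡j = i≡j
... | no  _   = ⊥-elim (δij≢0 refl)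

sum-δ* : ∀ {n} (i : Fin n) (f : Fin n → ℤ) → ∑[ k < n ] (δ i k * f k) ≡ f i
sum-δ* {suc n} zero    f = begin
  1ℤ * f zero + ∑[ k < n ] (0ℤ * f (suc k)) ≡⟨ cong₂ _+_ (ℤP.*-identityˡ (f zero)) (sum-replicate-zero n) ⟩
  f zero + 0ℤ                             ≡⟨ ℤP.+-identityʳ (f zero) ⟩
  f zero                                  ∎
  where open ≡-Reasoning
sum-δ* {suc n} (suc i) f = trans (ℤP.+-identityˡ _) (sum-δ* i (f ∘ suc))

sum-*δ : ∀ {n} (i : Fin n) (f : Fin n → ℤ) → ∑[ k < n ] (f k * δ k i) ≡ f i
sum-*δ i f = trans (sum-cong-≗ λ k → trans (ℤP.*-comm (f k) (δ k i)) (cong (_* f k) (δ-sym k i)))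
                   (sum-δ* i f)

sum-δ : ∀ {n} (i : Fin n) → sum (δ i) ≡ 1ℤ
sum-δ i = trans (sum-cong-≗ (λ k → sym (ℤP.*-identityʳ (δ i k)))) (sum-δ* i (λ _ → 1ℤ))

sum-minus-δ : ∀ {n} (f : Fin n → ℤ) i → ∑[ k < n ] (f k - δ i k) ≡ sum f - 1ℤ
sum-minus-δ f i = trans (sum-minus f (δ i)) (cong (λ s → sum f - s) (sum-δ i))

mult : ∀ {n d} → Vector (Fin n) d → Fin n → ℤ
mult {d = d} M k = ∑[ i < d ] δ (M i) k

sum-mult* : ∀ {n d} (M : Vector (Fin n) d) (g : Fin n → ℤ) →
  ∑[ k < n ] (mult M k * g k) ≡ ∑[ i < d ] g (M i)
sum-mult* {n} {d} M g = begin
  ∑[ k < n ] (mult M k * g k)             ≡⟨ sum-cong-≗ (λ k → *-distribʳ-sum (g k) (λ i → δ (M i) k)) ⟩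
  ∑[ k < n ] ∑[ i < d ] (δ (M i) k * g k) ≡⟨ ∑-comm (λ k i → δ (M i) k * g k) ⟩
  ∑[ i < d ] ∑[ k < n ] (δ (M i) k * g k) ≡⟨ sum-cong-≗ (λ i → sum-δ* (M i) g) ⟩
  ∑[ i < d ] g (M i)                       ∎
  where open ≡-Reasoning

mult-member : ∀ {n d} (M : Vector (Fin n) d) i → 1ℤ ≤ mult M (M i)
mult-member M i = subst (_≤ mult M (M i)) (δ-refl (M i)) (nonneg⇒≤sum (λ j → δ-nonneg (M j) (M i)) i)

mult≢0⇒member : ∀ {n d} (M : Vector (Fin n) d) {k} → mult M k ≢ 0ℤ → ∃ λ i → M i ≡ k
mult≢0⇒member M {k} mult≢0 with sum≢0⇒∃≢0 (λ i → δ (M i) k) mult≢0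
... | i , δ≢0 = i , δ≢0⇒≡ δ≢0

mult-tail≤ : ∀ {n d} (M : Vector (Fin n) (suc d)) k → mult (M ∘ suc) k ≤ mult M k
mult-tail≤ M k =
  subst (_≤ mult M k) (ℤP.+-identityˡ _) (ℤP.+-mono-≤ (δ-nonneg (M zero) k) ℤP.≤-refl)

mult≤1⇒head-fresh : ∀ {n d} (M : Vector (Fin n) (suc d)) → mult M (M zero) ≤ 1ℤ →
  ∀ {j} → M zero ≢ M (suc j)
mult≤1⇒head-fresh M mult≤1 {j} M₀≡Mⱼ = 2≰1 (ℤP.≤-trans twice mult≤1)
  where
  twice : 1ℤ + 1ℤ ≤ mult M (M zero)
  twice = ℤP.+-mono-≤ (ℤP.≤-reflexive (sym (δ-refl (M zero))))
            (subst (λ k → 1ℤ ≤ mult (M ∘ suc) k) (sym M₀≡Mⱼ) (mult-member (M ∘ suc) j))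
  2≰1 : ¬ (1ℤ + 1ℤ ≤ 1ℤ)
  2≰1 (+≤+ (s≤s ()))

mult≤1⇒injective : ∀ {n d} (M : Vector (Fin n) d) → (∀ k → mult M k ≤ 1ℤ) → Injective _≡_ _≡_ M
mult≤1⇒injective {d = suc d} M mult≤1 {zero}  {zero}  _ = refl
mult≤1⇒injective {d = suc d} M mult≤1 {zero}  {suc j} e = ⊥-elim (mult≤1⇒head-fresh M (mult≤1 _) e)
mult≤1⇒injective {d = suc d} M mult≤1 {suc i} {zero}  e = ⊥-elim (mult≤1⇒head-fresh M (mult≤1 _) (sym e))
mult≤1⇒injective {d = suc d} M mult≤1 {suc i} {suc j} e =
  cong suc (mult≤1⇒injective (M ∘ suc) (λ k → ℤP.≤-trans (mult-tail≤ M k) (mult≤1 k)) e)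

ZeroOne : ℤ → Set
ZeroOne x = x ≡ 0ℤ ⊎ x ≡ 1ℤ

zeroOne-nonneg : ∀ {x} → ZeroOne x → 0ℤ ≤ x
zeroOne-nonneg (inj₁ refl) = +≤+ z≤n
zeroOne-nonneg (inj₂ refl) = +≤+ z≤n

zeroOne-≤1 : ∀ {x} → ZeroOne x → x ≤ 1ℤ
zeroOne-≤1 (inj₁ refl) = +≤+ z≤n
zeroOne-≤1 (inj₂ refl) = +≤+ (s≤s z≤n)

zeroOne-≥1 : ∀ {x} → ZeroOne x → 1ℤ ≤ x → x ≡ 1ℤ
zeroOne-≥1 (inj₁ refl) (+≤+ ())
zeroOne-≥1 (inj₂ refl) _ = refl

zeroOne-minus-δ : ∀ {n} {f : Fin n → ℤ} {i} → (∀ k → ZeroOne (f k)) → f i ≡ 1ℤ →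
  ∀ k → ZeroOne (f k - δ i k)
zeroOne-minus-δ {f = f} {i} f01 fi≡1 k with i ≟ k
... | yes refl = inj₁ (cong (_- 1ℤ) fi≡1)
... | no  _    = subst ZeroOne (sym (ℤP.+-identityʳ (f k))) (f01 k)

-- Opaque lemmas here and below are used only through their statements; letting their proofs
-- unfold inside later types makes type checking blow up.
opaque
  zeroOne⇒mult : ∀ {n} (f : Fin n → ℤ) → (∀ k → ZeroOne (f k)) →
    ∀ d → sum f ≡ + d → ∃ λ (M : Vector (Fin n) d) → f ≗ mult M
  zeroOne⇒mult f f01 zero    Σf≡0 = [] , nonneg-sum≡0 (zeroOne-nonneg ∘ f01) Σf≡0
  zeroOne⇒mult f f01 (suc d) Σf≡1+d
    with sum≢0⇒∃≢0 f (λ Σf≡0 → case trans (sym Σf≡1+d) Σf≡0 of λ ())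
  ... | i , fi≢0 with f01 i
  ...   | inj₁ fi≡0 = ⊥-elim (fi≢0 fi≡0)
  ...   | inj₂ fi≡1 with zeroOne⇒mult (λ k → f k - δ i k) (zeroOne-minus-δ f01 fi≡1) d
                           (trans (sum-minus-δ f i) (cong (_- 1ℤ) Σf≡1+d))
  ...     | M , f-δᵢ≗M = (i ∷ M) , λ k → begin
    f k                      ≡⟨ x≡y+[x-y] (f k) (δ i k) ⟩
    δ i k + (f k - δ i k)    ≡⟨ cong (λ s → δ i k + s) (f-δᵢ≗M k) ⟩
    δ i k + mult M k         ∎
    where
    open ≡-Reasoning
    x≡y+[x-y] : ∀ x y → x ≡ y + (x - y)
    x≡y+[x-y] = solve-∀

module Enumeration {n d} {f : Fin n → ℤ} (f01 : ∀ k → ZeroOne (f k))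
                   {M : Vector (Fin n) d} (f≗M : f ≗ mult M) where

  enumerated-≡1 : ∀ i → f (M i) ≡ 1ℤ
  enumerated-≡1 i = zeroOne-≥1 (f01 (M i)) (subst (1ℤ ≤_) (sym (f≗M (M i))) (mult-member M i))

  enumeration-injective : Injective _≡_ _≡_ M
  enumeration-injective = mult≤1⇒injective M (λ k → subst (_≤ 1ℤ) (f≗M k) (zeroOne-≤1 (f01 k)))

  enumeration-complete : ∀ {k} → f k ≡ 1ℤ → ∃ λ i → M i ≡ k
  enumeration-complete fk≡1 = mult≢0⇒member M λ Mk≡0 → case trans (sym fk≡1) (trans (f≗M _) Mk≡0) of λ ()

Matrix : ℕ → Set
Matrix n = Fin n → Fin n → ℤ

infixl 7 _∙_
_∙_ : ∀ {n} → Matrix n → Matrix n → Matrix n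
(M ∙ N) i j = ∑[ k < _ ] (M i k * N k j)

∙-assoc : ∀ {n} (L M N : Matrix n) i j → ((L ∙ M) ∙ N) i j ≡ (L ∙ (M ∙ N)) i j
∙-assoc {n} L M N i j = begin
  ∑[ l < n ] (∑[ k < n ] (L i k * M k l) * N l j)   ≡⟨ sum-cong-≗ (λ l → *-distribʳ-sum (N l j) (λ k → L i k * M k l)) ⟩
  ∑[ l < n ] ∑[ k < n ] (L i k * M k l * N l j)     ≡⟨ ∑-comm (λ l k → L i k * M k l * N l j) ⟩
  ∑[ k < n ] ∑[ l < n ] (L i k * M k l * N l j)     ≡⟨ sum-cong-≗ (λ k → sum-cong-≗ λ l → ℤP.*-assoc (L i k) (M k l) (N l j)) ⟩
  ∑[ k < n ] ∑[ l < n ] (L i k * (M k l * N l j))   ≡⟨ sum-cong-≗ (λ k → sym (*-distribˡ-sum (L i k) (λ l → M k l * N l j))) ⟩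
  ∑[ k < n ] (L i k * ∑[ l < n ] (M k l * N l j))   ∎
  where open ≡-Reasoning

module _ {n} (G : SignedGraph n) where

  pos neg : Matrix n
  pos i j = 𝟙 ⌊ A G i j ℤ.≟ 1ℤ ⌋
  neg i j = 𝟙 ⌊ A G i j ℤ.≟ -1ℤ ⌋

  A≡pos-neg : ∀ i j → A G i j ≡ pos i j - neg i j
  A≡pos-neg i j with entries G i j
  ... | inj₁ e        rewrite e = refl
  ... | inj₂ (inj₁ e) rewrite e = refl
  ... | inj₂ (inj₂ e) rewrite e = refl

  A*A≡pos+neg : ∀ i j → A G i j * A G j i ≡ pos i j + neg i j
  A*A≡pos+neg i j rewrite symm G j i with entries G i j
  ... | inj₁ e        rewrite e = refl
  ... | inj₂ (inj₁ e) rewrite e = refl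
  ... | inj₂ (inj₂ e) rewrite e = refl

  adjacent≡pos+neg : ∀ i j → 𝟙 (not ⌊ A G i j ℤ.≟ 0ℤ ⌋) ≡ pos i j + neg i j
  adjacent≡pos+neg i j with entries G i j
  ... | inj₁ e        rewrite e = refl
  ... | inj₂ (inj₁ e) rewrite e = refl
  ... | inj₂ (inj₂ e) rewrite e = refl

  pos-zeroOne : ∀ i j → ZeroOne (pos i j)
  pos-zeroOne i j with ⌊ A G i j ℤ.≟ 1ℤ ⌋
  ... | true  = inj₂ refl
  ... | false = inj₁ refl

  neg-zeroOne : ∀ i j → ZeroOne (neg i j)
  neg-zeroOne i j with ⌊ A G i j ℤ.≟ -1ℤ ⌋
  ... | true  = inj₂ refl
  ... | false = inj₁ refl

  neg-sym : ∀ i j → neg i j ≡ neg j i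
  neg-sym i j = cong (λ x → 𝟙 ⌊ x ℤ.≟ -1ℤ ⌋) (symm G i j)

  pos≡1⇒A≡1 : ∀ {i j} → pos i j ≡ 1ℤ → A G i j ≡ 1ℤ
  pos≡1⇒A≡1 {i} {j} pos≡1 with A G i j ℤ.≟ 1ℤ | pos≡1
  ... | yes A≡1 | _  = A≡1
  ... | no  _   | ()

  A≡1⇒pos≡1 : ∀ {i j} → A G i j ≡ 1ℤ → pos i j ≡ 1ℤ
  A≡1⇒pos≡1 A≡1 rewrite A≡1 = refl

  neg≡1⇒A≡-1 : ∀ {i j} → neg i j ≡ 1ℤ → A G i j ≡ -1ℤ
  neg≡1⇒A≡-1 {i} {j} neg≡1 with A G i j ℤ.≟ -1ℤ | neg≡1
  ... | yes A≡-1 | _  = A≡-1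
  ... | no  _    | ()

  A≡-1⇒neg≡1 : ∀ {i j} → A G i j ≡ -1ℤ → neg i j ≡ 1ℤ
  A≡-1⇒neg≡1 A≡-1 rewrite A≡-1 = refl

  A²≡A∙A : ∀ i j → A² G i j ≡ (A G ∙ A G) i j
  A²≡A∙A i j = sumFin≡sum (λ k → A G i k * A G k j)

  +degree≡ : ∀ i → + degree G i ≡ sum (pos i) + sum (neg i)
  +degree≡ i = trans (+countFin≡sum (λ k → not ⌊ A G i k ℤ.≟ 0ℤ ⌋))
                     (trans (sum-cong-≗ (adjacent≡pos+neg i)) (∑-distrib-+ (pos i) (neg i)))

  netDegree≡ : ∀ i → netDegree G i ≡ sum (pos i) - sum (neg i)
  netDegree≡ i = cong₂ _-_ (+countFin≡sum (λ k → ⌊ A G i k ℤ.≟ 1ℤ ⌋))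
                           (+countFin≡sum (λ k → ⌊ A G i k ℤ.≟ -1ℤ ⌋))

  A²-diag : ∀ i → A² G i i ≡ + degree G i
  A²-diag i = begin
    A² G i i                 ≡⟨ A²≡A∙A i i ⟩
    (A G ∙ A G) i i          ≡⟨ sum-cong-≗ (A*A≡pos+neg i) ⟩
    ∑[ k < n ] (pos i k + neg i k) ≡⟨ ∑-distrib-+ (pos i) (neg i) ⟩
    sum (pos i) + sum (neg i) ≡⟨ +degree≡ i ⟨
    + degree G i             ∎
    where open ≡-Reasoning

  ±1 : ∀ {i j} → Adjacent G i j → A G i j ≡ 1ℤ ⊎ A G i j ≡ -1ℤ
  ±1 {i} {j} A≢0 with entries G i j
  ... | inj₁ e  = ⊥-elim (A≢0 e)
  ... | inj₂ e = e

  A≤1 : ∀ i j → A G i j ≤ 1ℤ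
  A≤1 i j with entries G i j
  ... | inj₁ e        rewrite e = +≤+ z≤n
  ... | inj₂ (inj₁ e) rewrite e = +≤+ (s≤s z≤n)
  ... | inj₂ (inj₂ e) rewrite e = -≤+

  A≢-1⇒nonneg : ∀ {i j} → A G i j ≢ -1ℤ → 0ℤ ≤ A G i j
  A≢-1⇒nonneg {i} {j} A≢-1 with entries G i j
  ... | inj₁ e        rewrite e = +≤+ z≤n
  ... | inj₂ (inj₁ e) rewrite e = +≤+ z≤n
  ... | inj₂ (inj₂ e) = ⊥-elim (A≢-1 e)

  degree<n : ∀ i → degree G i ℕ.< n
  degree<n i = countFin< _ {i} (cong (λ x → not ⌊ x ℤ.≟ 0ℤ ⌋) (loopless G i))

module StronglyRegular {n} {G : SignedGraph n} {r a b c} (S : IsSRSG G r a b c) where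
  open IsSRSG S

  ε : ℤ
  ε = a + b - + 2 * c

  A²-decomposition : ∀ i j →
    A² G i j ≡ c + (+ r - c) * δ i j + (a - c) * A G i j + ε * neg G i j
  A²-decomposition i j with i ≟ j
  ... | yes refl rewrite diag i | loopless G i = diagonal (+ r) a b c
    where diagonal : ∀ r a b c → r ≡ c + (r - c) * 1ℤ + (a - c) * 0ℤ + (a + b - + 2 * c) * 0ℤ
          diagonal = solve-∀
  ... | no i≢j with entries G i j
  ...   | inj₁ e        rewrite nonE i j i≢j e | e = nonEdge (+ r) a b c
    where nonEdge : ∀ r a b c → c ≡ c + (r - c) * 0ℤ + (a - c) * 0ℤ + (a + b - + 2 * c) * 0ℤ
          nonEdge = solve-∀
  ...   | inj₂ (inj₁ e) rewrite posE i j e | e = positive (+ r) a b c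
    where positive : ∀ r a b c → a ≡ c + (r - c) * 0ℤ + (a - c) * 1ℤ + (a + b - + 2 * c) * 0ℤ
          positive = solve-∀
  ...   | inj₂ (inj₂ e) rewrite negE i j e | e = negative (+ r) a b c
    where negative : ∀ r a b c → b ≡ c + (r - c) * 0ℤ + (a - c) * -1ℤ + (a + b - + 2 * c) * 1ℤ
          negative = solve-∀

  module _ {s} (row-sum : ∀ i → sum (A G i) ≡ s) where

    column-sum : ∀ j → ∑[ k < n ] A G k j ≡ s
    column-sum j = trans (sum-cong-≗ λ k → symm G k j) (row-sum j)

    A∙A²≡ : ∀ i j →
      (A G ∙ A² G) i j ≡ c * s + (+ r - c) * A G i j + (a - c) * A² G i j + ε * (A G ∙ neg G) i j
    A∙A²≡ i j = begin
      ∑[ k < n ] (A G i k * A² G k j)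
        ≡⟨ sum-cong-≗ (λ k → trans (cong (A G i k *_) (A²-decomposition k j))
                                    (expand (A G i k) c (+ r - c) (a - c) ε (δ k j) (A G k j) (neg G k j))) ⟩
      ∑[ k < n ] (c * A G i k + (+ r - c) * (A G i k * δ k j) + (a - c) * (A G i k * A G k j) + ε * (A G i k * neg G k j))
        ≡⟨ sum-lincomb c (+ r - c) (a - c) ε (A G i) (λ k → A G i k * δ k j) (λ k → A G i k * A G k j) (λ k → A G i k * neg G k j) ⟩
      c * sum (A G i) + (+ r - c) * ∑[ k < n ] (A G i k * δ k j) + (a - c) * (A G ∙ A G) i j + ε * (A G ∙ neg G) i j
        ≡⟨ cong₂ (λ x y → c * x + (+ r - c) * y + (a - c) * (A G ∙ A G) i j + ε * (A G ∙ neg G) i j)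
                 (row-sum i) (sum-*δ j (A G i)) ⟩
      c * s + (+ r - c) * A G i j + (a - c) * (A G ∙ A G) i j + ε * (A G ∙ neg G) i j
        ≡⟨ cong (λ x → c * s + (+ r - c) * A G i j + (a - c) * x + ε * (A G ∙ neg G) i j) (A²≡A∙A G i j) ⟨
      c * s + (+ r - c) * A G i j + (a - c) * A² G i j + ε * (A G ∙ neg G) i j ∎
      where
      open ≡-Reasoning
      expand : ∀ x c α β κ d y m → x * (c + α * d + β * y + κ * m) ≡ c * x + α * (x * d) + β * (x * y) + κ * (x * m)
      expand = solve-∀

    A²∙A≡ : ∀ i j →
      (A² G ∙ A G) i j ≡ c * s + (+ r - c) * A G i j + (a - c) * A² G i j + ε * (neg G ∙ A G) i j
    A²∙A≡ i j = begin
      ∑[ k < n ] (A² G i k * A G k j)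
        ≡⟨ sum-cong-≗ (λ k → trans (cong (_* A G k j) (A²-decomposition i k))
                                    (expand (A G k j) c (+ r - c) (a - c) ε (δ i k) (A G i k) (neg G i k))) ⟩
      ∑[ k < n ] (c * A G k j + (+ r - c) * (δ i k * A G k j) + (a - c) * (A G i k * A G k j) + ε * (neg G i k * A G k j))
        ≡⟨ sum-lincomb c (+ r - c) (a - c) ε (λ k → A G k j) (λ k → δ i k * A G k j) (λ k → A G i k * A G k j) (λ k → neg G i k * A G k j) ⟩
      c * ∑[ k < n ] A G k j + (+ r - c) * ∑[ k < n ] (δ i k * A G k j) + (a - c) * (A G ∙ A G) i j + ε * (neg G ∙ A G) i j
        ≡⟨ cong₂ (λ x y → c * x + (+ r - c) * y + (a - c) * (A G ∙ A G) i j + ε * (neg G ∙ A G) i j)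
                 (column-sum j) (sum-δ* i (λ k → A G k j)) ⟩
      c * s + (+ r - c) * A G i j + (a - c) * (A G ∙ A G) i j + ε * (neg G ∙ A G) i j
        ≡⟨ cong (λ x → c * s + (+ r - c) * A G i j + (a - c) * x + ε * (neg G ∙ A G) i j) (A²≡A∙A G i j) ⟨
      c * s + (+ r - c) * A G i j + (a - c) * A² G i j + ε * (neg G ∙ A G) i j ∎
      where
      open ≡-Reasoning
      expand : ∀ x c α β κ d y m → (c + α * d + β * y + κ * m) * x ≡ c * x + α * (d * x) + β * (y * x) + κ * (m * x)
      expand = solve-∀

    A∙A²≡A²∙A : ∀ i j → (A G ∙ A² G) i j ≡ (A² G ∙ A G) i j
    A∙A²≡A²∙A i j = begin
      (A G ∙ A² G) i j          ≡⟨ sum-cong-≗ (λ k → cong (A G i k *_) (A²≡A∙A G k j)) ⟩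
      (A G ∙ (A G ∙ A G)) i j   ≡⟨ ∙-assoc (A G) (A G) (A G) i j ⟨
      ((A G ∙ A G) ∙ A G) i j   ≡⟨ sum-cong-≗ (λ k → cong (_* A G k j) (A²≡A∙A G i k)) ⟨
      (A² G ∙ A G) i j          ∎
      where open ≡-Reasoning

    A∙neg≡neg∙A : ε ≢ 0ℤ → ∀ i j → (A G ∙ neg G) i j ≡ (neg G ∙ A G) i j
    A∙neg≡neg∙A ε≢0 i j = ℤP.*-cancelˡ-≡ ε _ _ {{ℤ.≢-nonZero ε≢0}}
      (∙-cancelˡ (c * s + (+ r - c) * A G i j + (a - c) * A² G i j) _ _ (trans (sym (A∙A²≡ i j)) (trans (A∙A²≡A²∙A i j) (A²∙A≡ i j))))

    sum-A²-row : ∀ i → sum (A² G i) ≡ s * s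
    sum-A²-row i = begin
      ∑[ j < n ] A² G i j                       ≡⟨ sum-cong-≗ (A²≡A∙A G i) ⟩
      ∑[ j < n ] ∑[ k < n ] (A G i k * A G k j) ≡⟨ ∑-comm (λ j k → A G i k * A G k j) ⟩
      ∑[ k < n ] ∑[ j < n ] (A G i k * A G k j) ≡⟨ sum-cong-≗ (λ k → *-distribˡ-sum (A G i k) (A G k)) ⟨
      ∑[ k < n ] (A G i k * sum (A G k))        ≡⟨ sum-cong-≗ (λ k → cong (A G i k *_) (row-sum k)) ⟩
      ∑[ k < n ] (A G i k * s)                  ≡⟨ *-distribʳ-sum s (A G i) ⟨
      sum (A G i) * s                           ≡⟨ cong (_* s) (row-sum i) ⟩
      s * s                                     ∎
      where open ≡-Reasoning

    s*s≡ : ∀ i → s * s ≡ c * + n + (+ r - c) + (a - c) * s + ε * sum (neg G i)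
    s*s≡ i = begin
      s * s
        ≡⟨ sum-A²-row i ⟨
      ∑[ j < n ] A² G i j
        ≡⟨ sum-cong-≗ (λ j → trans (A²-decomposition i j) (cong (λ x → x + (+ r - c) * δ i j + (a - c) * A G i j + ε * neg G i j) (sym (ℤP.*-identityʳ c)))) ⟩
      ∑[ j < n ] (c * 1ℤ + (+ r - c) * δ i j + (a - c) * A G i j + ε * neg G i j)
        ≡⟨ sum-lincomb c (+ r - c) (a - c) ε (λ _ → 1ℤ) (δ i) (A G i) (neg G i) ⟩
      c * ∑[ j < n ] 1ℤ + (+ r - c) * sum (δ i) + (a - c) * sum (A G i) + ε * sum (neg G i)
        ≡⟨ cong₂ (λ x y → c * x + (+ r - c) * y + (a - c) * sum (A G i) + ε * sum (neg G i)) (sum-one n) (sum-δ i) ⟩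
      c * + n + (+ r - c) * 1ℤ + (a - c) * sum (A G i) + ε * sum (neg G i)
        ≡⟨ cong₂ (λ x y → c * + n + x + (a - c) * y + ε * sum (neg G i)) (ℤP.*-identityʳ (+ r - c)) (row-sum i) ⟩
      c * + n + (+ r - c) + (a - c) * s + ε * sum (neg G i) ∎
      where open ≡-Reasoning

unbalanced-signs : ∀ {p q s} → p ≡ 1ℤ ⊎ p ≡ -1ℤ → q ≡ 1ℤ ⊎ q ≡ -1ℤ → s ≡ 1ℤ ⊎ s ≡ -1ℤ → p * q * s ≡ -1ℤ →
  (p ≡ -1ℤ × q ≡ 1ℤ × s ≡ 1ℤ) ⊎ (p ≡ 1ℤ × q ≡ -1ℤ × s ≡ 1ℤ) ⊎ (p ≡ 1ℤ × q ≡ 1ℤ × s ≡ -1ℤ) ⊎ (p ≡ -1ℤ × q ≡ -1ℤ × s ≡ -1ℤ)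
unbalanced-signs (inj₂ refl) (inj₁ refl) (inj₁ refl) _  = inj₁ (refl , refl , refl)
unbalanced-signs (inj₁ refl) (inj₂ refl) (inj₁ refl) _  = inj₂ (inj₁ (refl , refl , refl))
unbalanced-signs (inj₁ refl) (inj₁ refl) (inj₂ refl) _  = inj₂ (inj₂ (inj₁ (refl , refl , refl)))
unbalanced-signs (inj₂ refl) (inj₂ refl) (inj₂ refl) _  = inj₂ (inj₂ (inj₂ (refl , refl , refl)))
unbalanced-signs (inj₁ refl) (inj₁ refl) (inj₁ refl) ()
unbalanced-signs (inj₁ refl) (inj₂ refl) (inj₂ refl) ()
unbalanced-signs (inj₂ refl) (inj₁ refl) (inj₂ refl) ()
unbalanced-signs (inj₂ refl) (inj₂ refl) (inj₁ refl) ()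

cong-row : ∀ {p q r s t o p' q' r' s' t' o' : ℤ} → p ≡ p' → q ≡ q' → r ≡ r' → s ≡ s' → t ≡ t' → o ≡ o' →
  p + q + r + s + t - o ≡ p' + q' + r' + s' + t' - o'
cong-row refl refl refl refl refl refl = refl

c*[5+m]≢-4 : ∀ c m → c * (+ 5 + + m) ≢ - + 4
c*[5+m]≢-4 (+ zero)  m ()
c*[5+m]≢-4 (+ suc k) m ()
c*[5+m]≢-4 -[1+ k ]  m ()

arith-paired : ∀ {a b} c m → a ≡ c + + 2 → b ≡ + 4 →
  + 16 ≢ c * (+ 7 + + m) + (+ 6 - c) + (a - c) * + 4 + (a + b - + 2 * c)
arith-paired c m refl refl 16≡ = c*[5+m]≢-4 c m (begin
  c * (+ 5 + + m)                                                                     ≡⟨ identity c (+ m) ⟩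
  c * (+ 7 + + m) + (+ 6 - c) + (c + + 2 - c) * + 4 + (c + + 2 + + 4 - + 2 * c) - + 20 ≡⟨ cong (_- + 20) 16≡ ⟨
  + 16 - + 20                                                                         ∎)
  where
  open ≡-Reasoning
  identity : ∀ c m → c * (+ 5 + m) ≡ c * (+ 7 + m) + (+ 6 - c) + (c + + 2 - c) * + 4 + (c + + 2 + + 4 - + 2 * c) - + 20
  identity = solve-∀

-- The equations are A²(u, t) = a for t = x, y, z, w, w′, with px = A(x,w), qx = A(x,w′), sxy = A(x,y), ….
arith-unpaired : ∀ {a px py pz qx qy qz sxy sxz syz : ℤ} →
  a ≡ px + qx + 0ℤ + sxy + sxz - 0ℤ →
  a ≡ py + qy + sxy + 0ℤ + syz - 0ℤ →
  a ≡ pz + qz + sxz + syz + 0ℤ - 0ℤ →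
  a ≡ 0ℤ + -1ℤ + px + py + pz - 1ℤ →
  a ≡ -1ℤ + 0ℤ + qx + qy + qz - 1ℤ →
  0ℤ ≤ sxy → 0ℤ ≤ sxz → 0ℤ ≤ syz → px ≤ 1ℤ → py ≤ 1ℤ → pz ≤ 1ℤ → ⊥
arith-unpaired {a} {px} {py} {pz} {qx} {qy} {qz} {sxy} {sxz} {syz}
               ax ay az aw aw' sxy≥0 sxz≥0 syz≥0 px≤1 py≤1 pz≤1 = 3+nonneg≢0 slack≥0 (begin
  + 3 + slack
    ≡⟨ identity px py pz qx qy qz sxy sxz syz ⟩
  (px + qx + 0ℤ + sxy + sxz - 0ℤ) + (py + qy + sxy + 0ℤ + syz - 0ℤ) + (pz + qz + sxz + syz + 0ℤ - 0ℤ)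
    - ((0ℤ + -1ℤ + px + py + pz - 1ℤ) + (0ℤ + -1ℤ + px + py + pz - 1ℤ) + (-1ℤ + 0ℤ + qx + qy + qz - 1ℤ))
    ≡⟨ cong₂ _-_ (cong₂ _+_ (cong₂ _+_ ax ay) az) (cong₂ _+_ (cong₂ _+_ aw aw) aw') ⟨
  (a + a + a) - (a + a + a)
    ≡⟨ ℤP.+-inverseʳ (a + a + a) ⟩
  0ℤ ∎)
  where
  open ≡-Reasoning
  S = sxy + sxz + syz
  slack = (1ℤ - px) + (1ℤ - py) + (1ℤ - pz) + (S + S)
  slack≥0 : 0ℤ ≤ slack
  slack≥0 = ℤP.+-mono-≤ (ℤP.+-mono-≤ (ℤP.+-mono-≤ (ℤP.i≤j⇒0≤j-i px≤1) (ℤP.i≤j⇒0≤j-i py≤1)) (ℤP.i≤j⇒0≤j-i pz≤1))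
                        (ℤP.+-mono-≤ S≥0 S≥0)
    where S≥0 = ℤP.+-mono-≤ (ℤP.+-mono-≤ sxy≥0 sxz≥0) syz≥0
  3+nonneg≢0 : ∀ {x} → 0ℤ ≤ x → + 3 + x ≢ 0ℤ
  3+nonneg≢0 (+≤+ _) ()
  identity : ∀ px py pz qx qy qz sxy sxz syz →
    + 3 + ((1ℤ - px) + (1ℤ - py) + (1ℤ - pz) + ((sxy + sxz + syz) + (sxy + sxz + syz))) ≡
    (px + qx + 0ℤ + sxy + sxz - 0ℤ) + (py + qy + sxy + 0ℤ + syz - 0ℤ) + (pz + qz + sxz + syz + 0ℤ - 0ℤ)
    - ((0ℤ + -1ℤ + px + py + pz - 1ℤ) + (0ℤ + -1ℤ + px + py + pz - 1ℤ) + (-1ℤ + 0ℤ + qx + qy + qz - 1ℤ))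
  identity = solve-∀

module Regular6Net4 {n} {G : SignedGraph n} {r a b c} (S : IsSRSG G r a b c)
                    (reg : Regular G 6) (net : ∀ i → netDegree G i ≡ + 4) where
  open IsSRSG S
  open StronglyRegular S

  sum-neg≡1 : ∀ i → sum (neg G i) ≡ 1ℤ
  sum-neg≡1 i = ℤP.*-cancelˡ-≡ (+ 2) (sum (neg G i)) 1ℤ (begin
    + 2 * sum (neg G i)                                         ≡⟨ twice (sum (pos G i)) (sum (neg G i)) ⟩
    (sum (pos G i) + sum (neg G i)) - (sum (pos G i) - sum (neg G i)) ≡⟨ cong₂ _-_ (+degree≡ G i) (netDegree≡ G i) ⟨
    + degree G i - netDegree G i                                ≡⟨ cong₂ _-_ (cong +_ (reg i)) (net i) ⟩
    + 2 * 1ℤ                                                    ∎)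
    where
    open ≡-Reasoning
    twice : ∀ p q → + 2 * q ≡ (p + q) - (p - q)
    twice = solve-∀

  sum-A≡4 : ∀ i → sum (A G i) ≡ + 4
  sum-A≡4 i = begin
    sum (A G i)                             ≡⟨ sum-cong-≗ (A≡pos-neg G i) ⟩
    ∑[ k < n ] (pos G i k - neg G i k)      ≡⟨ sum-minus (pos G i) (neg G i) ⟩
    sum (pos G i) - sum (neg G i)           ≡⟨ netDegree≡ G i ⟨
    netDegree G i                           ≡⟨ net i ⟩
    + 4                                     ∎
    where open ≡-Reasoning

  sum-pos≡5 : ∀ i → sum (pos G i) ≡ + 5
  sum-pos≡5 i = begin
    sum (pos G i)                                   ≡⟨ p≡[p-q]+q (sum (pos G i)) (sum (neg G i)) ⟩
    (sum (pos G i) - sum (neg G i)) + sum (neg G i) ≡⟨ cong₂ _+_ (trans (sym (netDegree≡ G i)) (net i)) (sum-neg≡1 i) ⟩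
    + 4 + 1ℤ                                        ∎
    where
    open ≡-Reasoning
    p≡[p-q]+q : ∀ p q → p ≡ (p - q) + q
    p≡[p-q]+q = solve-∀

  opaque
    negative-neighbour : ∀ i → ∃ λ v → neg G i ≗ δ v
    negative-neighbour i = M zero , λ k → trans (neg≗M k) (ℤP.+-identityʳ (δ (M zero) k))
      where
      enumeration : ∃ λ (M : Vector (Fin n) 1) → neg G i ≗ mult M
      enumeration = zeroOne⇒mult (neg G i) (neg-zeroOne G i) 1 (sum-neg≡1 i)
      M : Vector (Fin n) 1
      M = proj₁ enumeration
      neg≗M : neg G i ≗ mult M
      neg≗M = proj₂ enumeration

    partner : Fin n → Fin n
    partner i = proj₁ (negative-neighbour i)

    neg≡δ-partner : ∀ i k → neg G i k ≡ δ (partner i) k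
    neg≡δ-partner i = proj₂ (negative-neighbour i)

  A-partner : ∀ i → A G i (partner i) ≡ -1ℤ
  A-partner i = neg≡1⇒A≡-1 G (trans (neg≡δ-partner i (partner i)) (δ-refl (partner i)))

  A≡-1⇒partner : ∀ {i k} → A G i k ≡ -1ℤ → partner i ≡ k
  A≡-1⇒partner {i} {k} A≡-1 = δ≢0⇒≡ λ δ≡0 →
    case trans (sym (A≡-1⇒neg≡1 G A≡-1)) (trans (neg≡δ-partner i k) δ≡0) of λ ()

  partner-involutive : ∀ i → partner (partner i) ≡ i
  partner-involutive i = A≡-1⇒partner (trans (symm G (partner i) i) (A-partner i))

  partner-injective : ∀ {i j} → partner i ≡ partner j → i ≡ j
  partner-injective {i} {j} e =
    trans (sym (partner-involutive i)) (trans (cong partner e) (partner-involutive j))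

  partner-irreflexive : ∀ i → partner i ≢ i
  partner-irreflexive i e = case trans (sym (loopless G i)) (subst (λ k → A G i k ≡ -1ℤ) e (A-partner i)) of λ ()

  opaque
    A-partner-comm : ε ≢ 0ℤ → ∀ i j → A G i (partner j) ≡ A G (partner i) j
    A-partner-comm ε≢0 i j = begin
      A G i (partner j)                    ≡⟨ sum-*δ (partner j) (A G i) ⟨
      ∑[ k < n ] (A G i k * δ k (partner j)) ≡⟨ sum-cong-≗ (λ k → cong (A G i k *_) (neg≡δ-partnerʳ k)) ⟨
      (A G ∙ neg G) i j                    ≡⟨ A∙neg≡neg∙A sum-A≡4 ε≢0 i j ⟩
      (neg G ∙ A G) i j                    ≡⟨ sum-cong-≗ (λ k → cong (_* A G k j) (neg≡δ-partner i k)) ⟩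
      ∑[ k < n ] (δ (partner i) k * A G k j) ≡⟨ sum-δ* (partner i) (λ k → A G k j) ⟩
      A G (partner i) j                    ∎
      where
      open ≡-Reasoning
      neg≡δ-partnerʳ : ∀ k → neg G k j ≡ δ k (partner j)
      neg≡δ-partnerʳ k = trans (neg-sym G k j) (trans (neg≡δ-partner j k) (δ-sym (partner j) k))

  7≤n : Fin n → 7 ℕ.≤ n
  7≤n i = subst (ℕ._< n) (reg i) (degree<n G i)

  r≡6 : Fin n → r ≡ 6
  r≡6 i = ℤP.+-injective (trans (sym (diag i)) (trans (A²-diag G i) (cong +_ (reg i))))

  opaque
    positive-neighbours : ∀ i {w w'} → A G i w ≡ 1ℤ → A G i w' ≡ 1ℤ → w ≢ w' →
      ∃ λ (X : Vector (Fin n) 3) → pos G i ≗ mult (w ∷ w' ∷ X)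
    positive-neighbours i {w} {w'} Aiw≡1 Aiw'≡1 w≢w' = X , pos≗X
      where
      rest : Fin n → ℤ
      rest k = pos G i k - δ w k - δ w' k
      rest01 : ∀ k → ZeroOne (rest k)
      rest01 = zeroOne-minus-δ (zeroOne-minus-δ (pos-zeroOne G i) (A≡1⇒pos≡1 G Aiw≡1))
                 (cong₂ _-_ (A≡1⇒pos≡1 G Aiw'≡1) (δ-≢ w≢w'))
      sum-rest : sum rest ≡ + 3
      sum-rest = trans (sum-minus-δ (λ k → pos G i k - δ w k) w')
                   (cong (_- 1ℤ) (trans (sum-minus-δ (pos G i) w) (cong (_- 1ℤ) (sum-pos≡5 i))))
      rest-enumeration : ∃ λ (X : Vector (Fin n) 3) → rest ≗ mult X
      rest-enumeration = zeroOne⇒mult rest rest01 3 sum-rest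
      X : Vector (Fin n) 3
      X = proj₁ rest-enumeration
      pos≗X : pos G i ≗ mult (w ∷ w' ∷ X)
      pos≗X k = begin
        pos G i k                       ≡⟨ p≡ (pos G i k) (δ w k) (δ w' k) ⟩
        δ w k + (δ w' k + rest k)       ≡⟨ cong (λ x → δ w k + (δ w' k + x)) (proj₂ rest-enumeration k) ⟩
        δ w k + (δ w' k + mult X k)     ∎
        where
        open ≡-Reasoning
        p≡ : ∀ p d d' → p ≡ d + (d' + (p - d - d'))
        p≡ = solve-∀

  A²-row-expansion : ∀ {i d} {M : Vector (Fin n) d} → pos G i ≗ mult M →
    ∀ j → A² G i j ≡ ∑[ t < d ] A G (M t) j - A G (partner i) j
  A²-row-expansion {i} {d} {M} pos≗M j = begin
    A² G i j                                                   ≡⟨ A²≡A∙A G i j ⟩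
    ∑[ k < n ] (A G i k * A G k j)                             ≡⟨ sum-cong-≗ (λ k → cong (_* A G k j) (trans (A≡pos-neg G i k) (cong₂ _-_ (pos≗M k) (neg≡δ-partner i k)))) ⟩
    ∑[ k < n ] ((mult M k - δ (partner i) k) * A G k j)        ≡⟨ sum-cong-≗ (λ k → distrib (mult M k) (δ (partner i) k) (A G k j)) ⟩
    ∑[ k < n ] (mult M k * A G k j - δ (partner i) k * A G k j) ≡⟨ sum-minus (λ k → mult M k * A G k j) (λ k → δ (partner i) k * A G k j) ⟩
    ∑[ k < n ] (mult M k * A G k j) - ∑[ k < n ] (δ (partner i) k * A G k j)
      ≡⟨ cong₂ _-_ (sum-mult* M (λ k → A G k j)) (sum-δ* (partner i) (λ k → A G k j)) ⟩
    ∑[ t < d ] A G (M t) j - A G (partner i) j                 ∎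
    where
    open ≡-Reasoning
    distrib : ∀ x y z → (x - y) * z ≡ x * z - y * z
    distrib = solve-∀

  negative-neighbour-unique : ∀ {i j k} → A G i j ≡ -1ℤ → A G i k ≡ -1ℤ → j ≡ k
  negative-neighbour-unique ij ik = trans (sym (A≡-1⇒partner ij)) (A≡-1⇒partner ik)

  partner-swap : ∀ {i j} → partner i ≡ j → partner j ≡ i
  partner-swap {i} e = trans (cong partner (sym e)) (partner-involutive i)

  0≤A-unless-partner : ∀ {i j} → partner i ≢ j → 0ℤ ≤ A G i j
  0≤A-unless-partner p≢j = A≢-1⇒nonneg G (p≢j ∘ A≡-1⇒partner)

  16≡ : Fin n → + 16 ≡ c * + n + (+ 6 - c) + (a - c) * + 4 + ε
  16≡ i = begin
    + 16                                                          ≡⟨ s*s≡ sum-A≡4 i ⟩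
    c * + n + (+ r - c) + (a - c) * + 4 + ε * sum (neg G i)       ≡⟨ cong₂ (λ x y → c * + n + (+ x - c) + (a - c) * + 4 + ε * y) (r≡6 i) (sum-neg≡1 i) ⟩
    c * + n + (+ 6 - c) + (a - c) * + 4 + ε * 1ℤ                  ≡⟨ cong (λ x → c * + n + (+ 6 - c) + (a - c) * + 4 + x) (ℤP.*-identityʳ ε) ⟩
    c * + n + (+ 6 - c) + (a - c) * + 4 + ε                       ∎
    where open ≡-Reasoning

  module Triangle (ε≢0 : ε ≢ 0ℤ) {u w : Fin n} (uw : A G u w ≡ 1ℤ) (vw : A G (partner u) w ≡ 1ℤ) where

    v w' : Fin n
    v  = partner u
    w' = partner w

    A-comm : ∀ i j → A G i (partner j) ≡ A G (partner i) j
    A-comm = A-partner-comm ε≢0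

    Av≡Au-partner : ∀ t → A G v t ≡ A G u (partner t)
    Av≡Au-partner t = sym (A-comm u t)

    uw' : A G u w' ≡ 1ℤ
    uw' = trans (A-comm u w) vw

    vw' : A G v w' ≡ 1ℤ
    vw' = trans (A-comm v w) (trans (cong (λ k → A G k w) (partner-involutive u)) uw)

    enumeration : ∃ λ (X : Vector (Fin n) 3) → pos G u ≗ mult (w ∷ w' ∷ X)
    enumeration = positive-neighbours u uw uw' (λ w≡w' → partner-irreflexive w (sym w≡w'))

    X : Vector (Fin n) 3
    X = proj₁ enumeration

    N⁺ : Vector (Fin n) 5
    N⁺ = w ∷ w' ∷ X

    open Enumeration (pos-zeroOne G u) {M = N⁺} (proj₂ enumeration)

    x y z : Fin n
    x = X 0F
    y = X 1F
    z = X 2F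

    N⁺-distinct : ∀ {i j} → i ≢ j → N⁺ i ≢ N⁺ j
    N⁺-distinct i≢j = i≢j ∘ enumeration-injective

    u-N⁺ : ∀ i → A G u (N⁺ i) ≡ 1ℤ
    u-N⁺ i = pos≡1⇒A≡1 G (enumerated-≡1 i)

    RowFormula : Fin n → Fin n → Fin n → Set
    RowFormula p q t = ∀ j → A² G u j ≡ A G w j + A G w' j + A G p j + A G q j + A G t j - A G v j

    row : RowFormula x y z
    row j = trans (A²-row-expansion {M = N⁺} (proj₂ enumeration) j)
                  (rebracket (A G w j) (A G w' j) (A G x j) (A G y j) (A G z j) (A G v j))
      where rebracket : ∀ p q r s t o → p + (q + (r + (s + (t + 0ℤ)))) - o ≡ p + q + r + s + t - o
            rebracket = solve-∀

    x≢y : x ≢ y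
    x≢y = N⁺-distinct {2F} {3F} (λ ())
    x≢z : x ≢ z
    x≢z = N⁺-distinct {2F} {4F} (λ ())
    y≢z : y ≢ z
    y≢z = N⁺-distinct {3F} {4F} (λ ())

    Av≡0 : ∀ i → partner (X i) ≢ x → partner (X i) ≢ y → partner (X i) ≢ z → A G v (X i) ≡ 0ℤ
    Av≡0 i ≢x ≢y ≢z with entries G u (partner (X i))
    ... | inj₁ e        = trans (Av≡Au-partner (X i)) e
    ... | inj₂ (inj₂ e) = ⊥-elim (u≢Xi (partner-injective (A≡-1⇒partner e)))
      where u≢Xi : u ≢ X i
            u≢Xi u≡Xi = case trans (sym (loopless G u)) (trans (cong (A G u) u≡Xi) (u-N⁺ (suc (suc i)))) of λ ()
    ... | inj₂ (inj₁ e) with enumeration-complete (A≡1⇒pos≡1 G e)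
    ...   | 0F , w≡Xi'  = ⊥-elim (N⁺-distinct {1F} {suc (suc i)} (λ ()) (partner-swap (sym w≡Xi')))
    ...   | 1F , w'≡Xi' = ⊥-elim (N⁺-distinct {suc (suc i)} {0F} (λ ()) (partner-injective (sym w'≡Xi')))
    ...   | 2F , x≡Xi'  = ⊥-elim (≢x (sym x≡Xi'))
    ...   | 3F , y≡Xi'  = ⊥-elim (≢y (sym y≡Xi'))
    ...   | 4F , z≡Xi'  = ⊥-elim (≢z (sym z≡Xi'))

    paired-impossible : ∀ {p q t} → RowFormula p q t →
      A G u p ≡ 1ℤ → A G u q ≡ 1ℤ → A G u t ≡ 1ℤ → partner p ≡ q → A G v t ≡ 0ℤ → ⊥
    paired-impossible {p} {q} {t} row-pqt up uq ut p'≡q vt with ℕP.m≤n⇒∃[o]m+o≡n (7≤n u)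
    ... | m , 7+m≡n = arith-paired c m a≡c+2 b≡4
      (subst (λ k → + 16 ≡ c * + k + (+ 6 - c) + (a - c) * + 4 + ε) (sym 7+m≡n) (16≡ u))
      where
      open ≡-Reasoning
      q'≡p : partner q ≡ p
      q'≡p = partner-swap p'≡q
      vp : A G v p ≡ 1ℤ
      vp = trans (Av≡Au-partner p) (trans (cong (A G u) p'≡q) uq)
      vq : A G v q ≡ 1ℤ
      vq = trans (Av≡Au-partner q) (trans (cong (A G u) q'≡p) up)
      ut' : A G u (partner t) ≡ 0ℤ
      ut' = trans (A-comm u t) vt
      u≢t' : u ≢ partner t
      u≢t' u≡t' = case trans (sym ut) (trans (cong (A G u) (sym (partner-swap (sym u≡t')))) (A-partner u)) of λ ()
      b≡4 : b ≡ + 4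
      b≡4 = begin
        b                                                          ≡⟨ negE u v (A-partner u) ⟨
        A² G u v                                                   ≡⟨ row-pqt v ⟩
        A G w v + A G w' v + A G p v + A G q v + A G t v - A G v v
          ≡⟨ cong-row (trans (symm G w v) vw) (trans (symm G w' v) vw') (trans (symm G p v) vp)
                      (trans (symm G q v) vq) (trans (symm G t v) vt) (loopless G v) ⟩
        + 4                                                        ∎
      c≡ : c ≡ A G w' t + A G w t + A G q t + A G p t + -1ℤ - 1ℤ
      c≡ = begin
        c                                     ≡⟨ nonE u (partner t) u≢t' ut' ⟨
        A² G u (partner t)                    ≡⟨ row-pqt (partner t) ⟩
        A G w (partner t) + A G w' (partner t) + A G p (partner t) + A G q (partner t) + A G t (partner t) - A G v (partner t)
          ≡⟨ cong-row (A-comm w t) (trans (A-comm w' t) (cong (λ k → A G k t) (partner-involutive w)))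
                      (trans (A-comm p t) (cong (λ k → A G k t) p'≡q)) (trans (A-comm q t) (cong (λ k → A G k t) q'≡p))
                      (A-partner t) (trans (A-comm v t) (trans (cong (λ k → A G k t) (partner-involutive u)) ut)) ⟩
        A G w' t + A G w t + A G q t + A G p t + -1ℤ - 1ℤ ∎
      a≡c+2 : a ≡ c + + 2
      a≡c+2 = begin
        a                                                          ≡⟨ posE u t ut ⟨
        A² G u t                                                   ≡⟨ row-pqt t ⟩
        A G w t + A G w' t + A G p t + A G q t + A G t t - A G v t ≡⟨ cong-row {p = A G w t} {q = A G w' t} {r = A G p t} {s = A G q t} refl refl refl refl (loopless G t) vt ⟩
        A G w t + A G w' t + A G p t + A G q t + 0ℤ - 0ℤ            ≡⟨ shift (A G w t) (A G w' t) (A G p t) (A G q t) ⟩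
        (A G w' t + A G w t + A G q t + A G p t + -1ℤ - 1ℤ) + + 2   ≡⟨ cong (_+ + 2) c≡ ⟨
        c + + 2                                                    ∎
        where shift : ∀ α β γ δ → α + β + γ + δ + 0ℤ - 0ℤ ≡ (β + α + δ + γ + -1ℤ - 1ℤ) + + 2
              shift = solve-∀

    unpaired-impossible : partner x ≢ y → partner x ≢ z → partner y ≢ z → ⊥
    unpaired-impossible x'≢y x'≢z y'≢z =
      arith-unpaired ax ay az aw aw'
        (0≤A-unless-partner x'≢y) (0≤A-unless-partner x'≢z) (0≤A-unless-partner y'≢z)
        (A≤1 G x w) (A≤1 G y w) (A≤1 G z w)
      where
      vx : A G v x ≡ 0ℤ
      vx = Av≡0 0F (partner-irreflexive x) x'≢y x'≢z
      vy : A G v y ≡ 0ℤ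
      vy = Av≡0 1F (x'≢y ∘ partner-swap) (partner-irreflexive y) y'≢z
      vz : A G v z ≡ 0ℤ
      vz = Av≡0 2F (x'≢z ∘ partner-swap) (y'≢z ∘ partner-swap) (partner-irreflexive z)
      a≡A²u : ∀ {t} → A G u t ≡ 1ℤ → a ≡ A² G u t
      a≡A²u ut = sym (posE u _ ut)
      ax : a ≡ A G x w + A G x w' + 0ℤ + A G x y + A G x z - 0ℤ
      ax = trans (a≡A²u (u-N⁺ 2F)) (trans (row x)
             (cong-row (symm G w x) (symm G w' x) (loopless G x) (symm G y x) (symm G z x) vx))
      ay : a ≡ A G y w + A G y w' + A G x y + 0ℤ + A G y z - 0ℤ
      ay = trans (a≡A²u (u-N⁺ 3F)) (trans (row y)
             (cong-row (symm G w y) (symm G w' y) refl (loopless G y) (symm G z y) vy))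
      az : a ≡ A G z w + A G z w' + A G x z + A G y z + 0ℤ - 0ℤ
      az = trans (a≡A²u (u-N⁺ 4F)) (trans (row z)
             (cong-row (symm G w z) (symm G w' z) refl refl (loopless G z) vz))
      aw : a ≡ 0ℤ + -1ℤ + A G x w + A G y w + A G z w - 1ℤ
      aw = trans (a≡A²u uw) (trans (row w)
             (cong-row (loopless G w) (trans (symm G w' w) (A-partner w)) refl refl refl vw))
      aw' : a ≡ -1ℤ + 0ℤ + A G x w' + A G y w' + A G z w' - 1ℤ
      aw' = trans (a≡A²u uw') (trans (row w')
              (cong-row (A-partner w) (loopless G w') refl refl refl vw'))

    row-xzy : RowFormula x z y
    row-xzy j = trans (row j) (swap (A G w j) (A G w' j) (A G x j) (A G y j) (A G z j) (A G v j))
      where swap : ∀ p q r s t o → p + q + r + s + t - o ≡ p + q + r + t + s - o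
            swap = solve-∀

    row-yzx : RowFormula y z x
    row-yzx j = trans (row j) (rotate (A G w j) (A G w' j) (A G x j) (A G y j) (A G z j) (A G v j))
      where rotate : ∀ p q r s t o → p + q + r + s + t - o ≡ p + q + s + t + r - o
            rotate = solve-∀

    impossible : ⊥
    impossible with partner x ≟ y | partner x ≟ z | partner y ≟ z
    ... | yes x'≡y | _        | _        = paired-impossible row (u-N⁺ 2F) (u-N⁺ 3F) (u-N⁺ 4F) x'≡y
      (Av≡0 2F (λ z'≡x → y≢z (trans (sym x'≡y) (partner-swap z'≡x)))
               (λ z'≡y → x≢z (trans (sym (partner-swap x'≡y)) (partner-swap z'≡y)))
               (partner-irreflexive z))
    ... | no x'≢y  | yes x'≡z | _        = paired-impossible row-xzy (u-N⁺ 2F) (u-N⁺ 4F) (u-N⁺ 3F) x'≡z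
      (Av≡0 1F (x'≢y ∘ partner-swap)
               (partner-irreflexive y)
               (λ y'≡z → x≢y (trans (sym (partner-swap x'≡z)) (partner-swap y'≡z))))
    ... | no x'≢y  | no x'≢z  | yes y'≡z = paired-impossible row-yzx (u-N⁺ 3F) (u-N⁺ 4F) (u-N⁺ 2F) y'≡z
      (Av≡0 0F (partner-irreflexive x) x'≢y x'≢z)
    ... | no x'≢y  | no x'≢z  | no y'≢z  = unpaired-impossible x'≢y x'≢z y'≢z

  one-negative-edge-impossible : ε ≢ 0ℤ → ∀ {u v w} → A G u v ≡ -1ℤ → A G v w ≡ 1ℤ → A G w u ≡ 1ℤ → ⊥
  one-negative-edge-impossible ε≢0 {u} {v} {w} uv vw wu = Triangle.impossible ε≢0 (trans (symm G u w) wu)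
    (subst (λ t → A G t w ≡ 1ℤ) (sym (A≡-1⇒partner uv)) vw)

  no-unbalanced-triangle : ε ≢ 0ℤ → ∀ i j k → ¬ UnbalancedTriangle G i j k
  no-unbalanced-triangle ε≢0 i j k (ij≢0 , jk≢0 , ki≢0 , sign)
    with unbalanced-signs (±1 G ij≢0) (±1 G jk≢0) (±1 G ki≢0) sign
  ... | inj₁ (ij , jk , ki)               = one-negative-edge-impossible ε≢0 ij jk ki
  ... | inj₂ (inj₁ (ij , jk , ki))        = one-negative-edge-impossible ε≢0 jk ki ij
  ... | inj₂ (inj₂ (inj₁ (ij , jk , ki))) = one-negative-edge-impossible ε≢0 ki ij jk
  ... | inj₂ (inj₂ (inj₂ (ij , _ , ki)))  =
    jk≢0 (trans (cong (A G j) (sym (negative-neighbour-unique ij (trans (symm G i k) ki)))) (loopless G j))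

classes⇒a+b≢2c : ∀ {n} {G : SignedGraph n} {a b c} → ¬ Complete G →
  ClassC1 G a b c ⊎ (ClassC4 G a b c ⊎ ClassC5 G a b c) → a + b ≢ + 2 * c
classes⇒a+b≢2c ¬complete (inj₁ (_ , inj₁ complete))            _ = ¬complete complete
classes⇒a+b≢2c {b = b} _ (inj₁ (refl , inj₂ (_ , c≢0)))       a+b≡2c =
  c≢0 ([ (λ ()) , id ]′ (ℤP.i*j≡0⇒i≡0∨j≡0 (+ 2) (trans (sym a+b≡2c) (ℤP.+-inverseˡ b))))
classes⇒a+b≢2c {a = a} {b} _ (inj₂ (inj₁ (a≢-b , _ , refl))) a+b≡0 =
  a≢-b (ℤP.i-j≡0⇒i≡j a (- b) (trans (cong (λ x → a + x) (ℤP.neg-involutive b)) a+b≡0))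
classes⇒a+b≢2c _ (inj₂ (inj₂ (_ , _ , 2c≢a+b , _)))          a+b≡2c = 2c≢a+b (sym a+b≡2c)

lemma3p1 : (n : ℕ) (G : SignedGraph n) (r : ℕ) (a b c : ℤ)
    → IsSRSG G r a b c
    → Inhomogeneous G
    → ClassC1 G a b c ⊎ (ClassC4 G a b c ⊎ ClassC5 G a b c)
    → Connected G
    → ¬ Complete G
    → Regular G 6
    → (∀ i → netDegree G i ≡ + 4)
    → ∀ (i j k : Fin n) → ¬ UnbalancedTriangle G i j k
lemma3p1 n G r a b c S _ class _ ¬complete reg net =
  Regular6Net4.no-unbalanced-triangle S reg net
    (classes⇒a+b≢2c {G = G} ¬complete class ∘ ℤP.i-j≡0⇒i≡j (a + b) (+ 2 * c))
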